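{- For all states $s,s'$ of the Findel execution model and every event $e$: if $s\rightsquigarrow s'$ and $e\in\mathtt{E}(s)$, then $e\in\mathtt{E}(s')$.
   Context: Model of the Findel language. Addresses, identifiers and times are natural numbers. Primitives: $\mathtt{Zero}$, $\mathtt{One}(cur)$, $\mathtt{Scale}(k,P)$, $\mathtt{ScaleObs}(a,P)$, $\mathtt{Give}(P)$, $\mathtt{And}(P_1,P_2)$, $\mathtt{Or}(P_1,P_2)$, $\mathtt{If}(a,P_1,P_2)$, $\mathtt{Timebound}(t_0,t_1,P)$. A contract $c$ has fields $\mathit{id}(c)$, $\mathit{dsc}(c)$, $\mathit{prim}(c)$, $\mathit{issuer}(c)$, $\mathit{owner}(c)$, proposed owner $\mathit{po}(c)$, scale $\mathit{sc}(c)$; a description $d$ has $\mathit{id}(d),\mathit{prim}(d),\mathit{sc}(d),\mathit{vfrom}(d),\mathit{vuntil}(d)$. Events are $\mathtt{Executed}\ j$, $\mathtt{Deleted}\ j$, $\mathtt{IssuedFor}\ a\ j$. $\mathrm{execute}(P,sc,I,O,B,t,\mathcal{G},cid,did,n,L)$ returns $\bot$ or $(B',C',n',L')$ (balance, generated contracts, fresh id, ledger): $\mathtt{Zero}\mapsto(B,[],n,L)$; $\mathtt{One}(cur)$ transfers $sc$ units of $cur$ from $I$ to $O$, returns no contracts, fresh id $n+1$, and prepends the transaction (id $n$, contract $cid$, from $I$, to $O$, amount $sc$, currency $cur$, time $t$) to $L$; $\mathtt{Scale}(k,P')$ executes $P'$ with scale $sc\cdot k$; $\mathtt{ScaleObs}(a,P')$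 is $\bot$ if $\mathrm{query}(\mathcal{G},a,t)=\mathtt{None}$, else executes $P'$ with scale $sc\cdot v$; $\mathtt{Give}(P')$ swaps $I,O$; $\mathtt{And}(P_1,P_2)$ executes $P_1$ then $P_2$, threading balance, fresh id and ledger and concatenating contracts, $\bot$ if either fails; $\mathtt{If}(a,P_1,P_2)$ is $\bot$ on query failure, executes $P_2$ if the value is $0$, else $P_1$; $\mathtt{Timebound}(t_0,t_1,P')$ is $\bot$ if $t_1<t$, executes $P'$ if $t_0<t\le t_1$, else returns $(B,[c'],n+2,L)$ with $c'$ = (id $n+1$, description $did$, primitive $\mathtt{Timebound}(t_0,t_1,P')$, issuer $I$, owner $O$, proposed owner $O$, scale $sc$); $\mathtt{Or}(P_1,P_2)\mapsto(B,[c'],n+2,L)$ with $c'$ analogous with primitive $\mathtt{Or}(P_1,P_2)$. A state is $s=\langle\mathcal{C},\mathcal{D},\mathcal{B},t,\mathcal{G},i,\mathcal{L},\mathtt{E}\rangle$ with event list $\mathtt{E}(s)$. Steps $s\curvearrowright s'$: [Issue] for $d\in\mathcal{D}$ and addresses $I,O$: prepend contract (id $i$, description $\mathit{id}(d)$, primitive $\mathit{prim}(d)$, issuer $I$, owner $I$, proposed owner $O$, scale $\mathit{sc}(d)$), fresh id $i+1$, prepend $\mathtt{IssuedFor}\ O\ i$ to $\mathtt{E}$. [Join] for $c\in\mathcal{C}$, address $O$, with $\mathit{po}(c)\in\{O,0\}$, $\mathit{prim}(c)$ not an $\mathtt{Or}$, description $d$ of $c$ with $\mathit{vfrom}(d)\le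 t\le\mathit{vuntil}(d)$, and $\mathrm{execute}(\mathit{prim}(c),\mathit{sc}(c),\mathit{issuer}(c),O,\mathcal{B},t,\mathcal{G},\mathit{id}(c),\mathit{dsc}(c),i,\mathcal{L})=(\mathcal{B}',\mathcal{C}',i',\mathcal{L}')$: contracts become $(\mathcal{C}\setminus\{c\})\cup\mathcal{C}'$, balance $\mathcal{B}'$, fresh id $i'$, ledger $\mathcal{L}'$, prepend $\mathtt{Executed}\ \mathit{id}(c)$. [Join Or] as Join with $\mathit{prim}(c)=\mathtt{Or}(P_1,P_2)$, executing a chosen $P\in\{P_1,P_2\}$. [Fail] under the proposed-owner and validity-time conditions, if the corresponding execution returns $\bot$: remove $c$, prepend $\mathtt{Deleted}\ \mathit{id}(c)$. [Tick] time $t\mapsto t+1$. $\rightsquigarrow$ is the reflexive–transitive closure of $\curvearrowright$. -}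

module Defs where

open import Data.Nat using (ℕ; zero; suc; _+_; _*_; _≤_; _<_; _≤ᵇ_; _<ᵇ_; _≡ᵇ_)
open import Data.Integer as ℤ using (ℤ; +_)
open import Data.Bool using (Bool; true; false; if_then_else_; _∧_)
open import Data.Maybe using (Maybe; just; nothing)
open import Data.List using (List; []; _∷_; _++_)
open import Data.List.Membership.Propositional using (_∈_)
open import Data.Product using (_×_; _,_; Σ; ∃)
open import Relation.Binary.PropositionalEquality using (_≡_)
open import Relation.Nullary using (¬_)
import Data.Sum
open import Relation.Binary.Construct.Closure.ReflexiveTransitive using (Star)

Address : Set
Address = ℕ

Ident : Set
Ident = ℕ

Time : Set
Time = ℕ

Currency : Set
Currency = ℕ

data Prim : Set where
  Zero      : Prim
  One       : Currency → Prim
  Scale     : ℕ → Prim → Prim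
  ScaleObs  : Address → Prim → Prim
  Give      : Prim → Prim
  And       : Prim → Prim → Prim
  Or        : Prim → Prim → Prim
  If        : Address → Prim → Prim → Prim
  Timebound : Time → Time → Prim → Prim

record Contract : Set where
  constructor mkContract
  field
    cid    : Ident
    dsc    : Ident
    prim   : Prim
    issuer : Address
    owner  : Address
    po     : Address
    sc     : ℕ
open Contract public

record Description : Set where
  constructor mkDescription
  field
    did    : Ident
    dprim  : Prim
    dsc'   : ℕ
    vfrom  : Time
    vuntil : Time
open Description public

record Transaction : Set where
  constructor mkTransaction
  field
    tid   : Ident
    tcid  : Ident
    tfrom : Address
    tto   : Address
    tamt  : ℕ
    tcur  : Currency
    ttime : Time

Ledger : Set
Ledger = List Transaction

Balance : Set
Balance = Address → Currency → ℤ

Gateway : Set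
Gateway = Address → Time → Maybe ℕ

query : Gateway → Address → Time → Maybe ℕ
query G a t = G a t

transfer : Balance → Address → Address → Currency → ℕ → Balance
transfer B I O cur amt a c =
  let b₁ = if (c ≡ᵇ cur) ∧ (a ≡ᵇ I) then B a c ℤ.- (+ amt) else B a c
  in  if (c ≡ᵇ cur) ∧ (a ≡ᵇ O) then b₁ ℤ.+ (+ amt) else b₁

Result : Set
Result = Balance × List Contract × Ident × Ledger

execute : Prim → ℕ → Address → Address → Balance → Time → Gateway
        → Ident → Ident → Ident → Ledger → Maybe Result
execute Zero sc I O B t G cid did n L = just (B , [] , n , L)
execute (One cur) sc I O B t G cid did n L =
  just (transfer B I O cur sc , [] , suc n , mkTransaction n cid I O sc cur t ∷ L)
execute (Scale k P) sc I O B t G cid did n L = execute P (sc * k) I O B t G cid did n L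
execute (ScaleObs a P) sc I O B t G cid did n L with query G a t
... | nothing = nothing
... | just v  = execute P (sc * v) I O B t G cid did n L
execute (Give P) sc I O B t G cid did n L = execute P sc O I B t G cid did n L
execute (And P₁ P₂) sc I O B t G cid did n L with execute P₁ sc I O B t G cid did n L
... | nothing = nothing
... | just (B₁ , C₁ , n₁ , L₁) with execute P₂ sc I O B₁ t G cid did n₁ L₁
...   | nothing = nothing
...   | just (B₂ , C₂ , n₂ , L₂) = just (B₂ , C₁ ++ C₂ , n₂ , L₂)
execute (If a P₁ P₂) sc I O B t G cid did n L with query G a t
... | nothing = nothing
... | just zero    = execute P₂ sc I O B t G cid did n L
... | just (suc _) = execute P₁ sc I O B t G cid did n L
execute (Timebound t₀ t₁ P) sc I O B t G cid did n L =
  if t₁ <ᵇ t then nothing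
  else if t₀ <ᵇ t then execute P sc I O B t G cid did n L
  else just (B , mkContract (suc n) did (Timebound t₀ t₁ P) I O O sc ∷ [] , suc (suc n) , L)
execute (Or P₁ P₂) sc I O B t G cid did n L =
  just (B , mkContract (suc n) did (Or P₁ P₂) I O O sc ∷ [] , suc (suc n) , L)

data Event : Set where
  Executed  : Ident → Event
  Deleted   : Ident → Event
  IssuedFor : Address → Ident → Event

record State : Set where
  constructor ⟨_,_,_,_,_,_,_,_⟩
  field
    contracts : List Contract
    descs     : List Description
    balance   : Balance
    time      : Time
    gateway   : Gateway
    fresh     : Ident
    ledger    : Ledger
    events    : List Event
open State public

data IsOr : Prim → Set where
  isOr : ∀ P₁ P₂ → IsOr (Or P₁ P₂)

ValidDesc : List Description → Contract → Time → Description → Set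
ValidDesc D c t d = d ∈ D × did d ≡ dsc c × vfrom d ≤ t × t ≤ vuntil d

-- one step  s ↷ s'
-- The contract set is represented as a list; removing c is splitting
-- the list as C₁ ++ c ∷ C₂ and keeping C₁ ++ C₂.
data _↷_ : State → State → Set where
  issue : ∀ {C D B t G i L E} (d : Description) (I O : Address) → d ∈ D →
    ⟨ C , D , B , t , G , i , L , E ⟩ ↷
    ⟨ mkContract i (did d) (dprim d) I I O (dsc' d) ∷ C , D , B , t , G , suc i , L , IssuedFor O i ∷ E ⟩
  join : ∀ {C₁ C₂ D B t G i L E} (c : Contract) (O : Address) (d : Description)
    {B' C' i' L'} →
    (po c ≡ O Data.Sum.⊎ po c ≡ 0) → ¬ IsOr (prim c) → ValidDesc D c t d →
    execute (prim c) (sc c) (issuer c) O B t G (cid c) (dsc c) i L ≡ just (B' , C' , i' , L') →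
    ⟨ C₁ ++ c ∷ C₂ , D , B , t , G , i , L , E ⟩ ↷
    ⟨ (C₁ ++ C₂) ++ C' , D , B' , t , G , i' , L' , Executed (cid c) ∷ E ⟩
  joinOr : ∀ {C₁ C₂ D B t G i L E} (c : Contract) (O : Address) (d : Description)
    {P₁ P₂ P B' C' i' L'} →
    (po c ≡ O Data.Sum.⊎ po c ≡ 0) → prim c ≡ Or P₁ P₂ → (P ≡ P₁ Data.Sum.⊎ P ≡ P₂) →
    ValidDesc D c t d →
    execute P (sc c) (issuer c) O B t G (cid c) (dsc c) i L ≡ just (B' , C' , i' , L') →
    ⟨ C₁ ++ c ∷ C₂ , D , B , t , G , i , L , E ⟩ ↷
    ⟨ (C₁ ++ C₂) ++ C' , D , B' , t , G , i' , L' , Executed (cid c) ∷ E ⟩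
  fail : ∀ {C₁ C₂ D B t G i L E} (c : Contract) (O : Address) (d : Description) →
    (po c ≡ O Data.Sum.⊎ po c ≡ 0) → ¬ IsOr (prim c) → ValidDesc D c t d →
    execute (prim c) (sc c) (issuer c) O B t G (cid c) (dsc c) i L ≡ nothing →
    ⟨ C₁ ++ c ∷ C₂ , D , B , t , G , i , L , E ⟩ ↷
    ⟨ C₁ ++ C₂ , D , B , t , G , i , L , Deleted (cid c) ∷ E ⟩
  failOr : ∀ {C₁ C₂ D B t G i L E} (c : Contract) (O : Address) (d : Description) {P₁ P₂ P} →
    (po c ≡ O Data.Sum.⊎ po c ≡ 0) → prim c ≡ Or P₁ P₂ → (P ≡ P₁ Data.Sum.⊎ P ≡ P₂) →
    ValidDesc D c t d →
    execute P (sc c) (issuer c) O B t G (cid c) (dsc c) i L ≡ nothing →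
    ⟨ C₁ ++ c ∷ C₂ , D , B , t , G , i , L , E ⟩ ↷
    ⟨ C₁ ++ C₂ , D , B , t , G , i , L , Deleted (cid c) ∷ E ⟩
  tick : ∀ {C D B t G i L E} →
    ⟨ C , D , B , t , G , i , L , E ⟩ ↷ ⟨ C , D , B , suc t , G , i , L , E ⟩

_↝_ : State → State → Set
_↝_ = Star _↷_

module Submission where

-- The event list of a Findel state is an append-only log: the rules Issue,
-- Join, Join Or, Fail (and its Or variant) each prepend exactly one event,
-- and Tick leaves the log untouched.

open import Defs
open import Data.List using (_∷_)
open import Data.List.Membership.Propositional using (_∈_)
open import Data.List.Relation.Unary.Any using (there)
open import Data.List.Relation.Binary.Subset.Propositional using (_⊆_)
open import Data.List.Relation.Binary.Subset.Propositional.Properties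
  using (⊆-refl)
open import Data.Product using (∃-syntax; _,_)
open import Data.Sum using (_⊎_; inj₁; inj₂)
open import Function using (_∘_; _on_)
open import Relation.Binary.PropositionalEquality using (_≡_; refl)
open import Relation.Binary.Construct.Closure.ReflexiveTransitive using (fold)

step-log : ∀ {s s' : State} → s ↷ s' →
           events s' ≡ events s ⊎ ∃[ e ] events s' ≡ e ∷ events s
step-log (issue _ _ O _)          = inj₂ (IssuedFor O _ , refl)
step-log (join c _ _ _ _ _ _)     = inj₂ (Executed (cid c) , refl)
step-log (joinOr c _ _ _ _ _ _ _) = inj₂ (Executed (cid c) , refl)
step-log (fail c _ _ _ _ _ _)     = inj₂ (Deleted (cid c) , refl)
step-log (failOr c _ _ _ _ _ _ _) = inj₂ (Deleted (cid c) , refl)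
step-log tick                     = inj₁ refl

step-events-⊆ : ∀ {s s' : State} → s ↷ s' → events s ⊆ events s'
step-events-⊆ r with step-log r
... | inj₁ eq rewrite eq = ⊆-refl
... | inj₂ (_ , eq) rewrite eq = there

events-monotone : ∀ {s s' : State} → s ↝ s' → events s ⊆ events s'
events-monotone = fold (_⊆_ on events) (λ r later → later ∘ step-events-⊆ r) ⊆-refl

theorem3 : ∀ (s s' : State) (e : Event) → s ↝ s' → e ∈ events s → e ∈ events s'
theorem3 s s' e run = events-monotone run
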